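{- Let $G$ be a finite simple graph, $A_1,A_2$ disjoint subsets of $V(G)$, and $G^*$ the graph obtained by toggling all pairs between $A_1$ and $A_2$, with closed neighborhood matrices $N$ and $N^*$. Suppose $A_1$ and $A_2$ are HO sets and $A_1\cup A_2$ is an NO set in $G$. Then for every pattern $\mathbf{p}$, $N^*\mathbf{p}=\mathbf{1}$ if and only if either ($N\mathbf{p}=\mathbf{1}$ and $\mathbf{x}_{A_1}\cdot\mathbf{p}=\mathbf{x}_{A_2}\cdot\mathbf{p}=0$) or ($N\mathbf{p}=\overline{\mathbf{x}_{A_1\cup A_2}}$ and $\mathbf{x}_{A_1}\cdot\mathbf{p}=\mathbf{x}_{A_2}\cdot\mathbf{p}=1$). Moreover, $A_1$ and $A_2$ are HO in $G^*$ and $\nu(G^*)=\nu(G)$.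
   Context: For a graph $H$ with vertex set $V=\{v_1,\dots,v_n\}$, $N(H)$ is the closed neighborhood matrix over $\mathbb{Z}_2$ (entry $(i,j)$ is $1$ iff $i=j$ or $v_iv_j$ is an edge), $\nu(H)=\dim\ker N(H)$. Given disjoint $A_1,A_2\subseteq V(G)$, $G^*$ is obtained from $G$ by, for every $u\in A_1$, $v\in A_2$, adding the edge $uv$ if $u,v$ are non-adjacent and removing it if they are adjacent; $N=N(G)$, $N^*=N(G^*)$. Subsets $A$ are identified with characteristic vectors $\mathbf{x}_A$; $\mathbf{x}\cdot\mathbf{y}=\mathbf{x}^t\mathbf{y}$ over $\mathbb{Z}_2$; $\mathbf{1}$ is the all-ones vector, $\overline{\mathbf{x}}:=\mathbf{x}+\mathbf{1}$. In a graph $H$ with matrix $M$: a set $A$ is solvable if $M\mathbf{p}=\mathbf{x}_A$ has a solution; $A$ is HO if it is not solvable. For solvable $A$, $A$ is AO if $\mathbf{x}_A\cdot\mathbf{p}=1$ for all $\mathbf{p}$ with $M\mathbf{p}=\mathbf{1}$, and NO if $\mathbf{x}_A\cdot\mathbf{p}=0$ for all such $\mathbf{p}$ (such $\mathbf{p}$ always exist). -}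

module Defs where

open import Data.Bool using (Bool; true; false; _∧_; _∨_; _xor_; not; if_then_else_)
open import Data.Nat using (ℕ; zero; suc)
open import Data.Fin using (Fin; zero; suc; _≟_)
open import Data.Product using (Σ; ∃; _×_; _,_)
open import Relation.Nullary using (¬_; does)
open import Relation.Binary.PropositionalEquality using (_≡_; refl)

-- Vectors over Z₂ (Bool with xor as addition, ∧ as multiplication);
-- a subset of V = Fin n is identified with its characteristic vector.
BVec : ℕ → Set
BVec n = Fin n → Bool

_≋_ : ∀ {n} → BVec n → BVec n → Set
x ≋ y = ∀ i → x i ≡ y i

sumZ2 : ∀ {n} → BVec n → Bool
sumZ2 {zero} x = false
sumZ2 {suc n} x = x zero xor sumZ2 (λ i → x (suc i))

_·_ : ∀ {n} → BVec n → BVec n → Bool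
x · y = sumZ2 (λ i → x i ∧ y i)

𝟏 : ∀ {n} → BVec n
𝟏 _ = true

𝟎 : ∀ {n} → BVec n
𝟎 _ = false

‾ : ∀ {n} → BVec n → BVec n
‾ x i = not (x i)

_∪_ : ∀ {n} → BVec n → BVec n → BVec n
(x ∪ y) i = x i ∨ y i

Mat : ℕ → Set
Mat n = Fin n → Fin n → Bool

_*ᵥ_ : ∀ {n} → Mat n → BVec n → BVec n
(M *ᵥ p) i = M i · p

record Graph (n : ℕ) : Set where
  field
    adj   : Fin n → Fin n → Bool
    sym   : ∀ i j → adj i j ≡ adj j i
    loopless : ∀ i → adj i i ≡ false
open Graph public

N : ∀ {n} → Graph n → Mat n
N H i j = if does (i ≟ j) then true else adj H i j

Disjoint : ∀ {n} → BVec n → BVec n → Set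
Disjoint A₁ A₂ = ∀ i → A₁ i ∧ A₂ i ≡ false

private
  toggleAdj : ∀ {n} → Graph n → BVec n → BVec n → Fin n → Fin n → Bool
  toggleAdj G A₁ A₂ i j = adj G i j xor ((A₁ i ∧ A₂ j) ∨ (A₂ i ∧ A₁ j))

  ∨-comm' : ∀ a b → a ∨ b ≡ b ∨ a
  ∨-comm' false false = refl
  ∨-comm' false true = refl
  ∨-comm' true false = refl
  ∨-comm' true true = refl

  ∧-comm' : ∀ a b → a ∧ b ≡ b ∧ a
  ∧-comm' false false = refl
  ∧-comm' false true = refl
  ∧-comm' true false = refl
  ∧-comm' true true = refl

  toggleSym : ∀ {n} (G : Graph n) A₁ A₂ i j → toggleAdj G A₁ A₂ i j ≡ toggleAdj G A₁ A₂ j i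
  toggleSym G A₁ A₂ i j with adj G i j | adj G j i | sym G i j | A₁ i | A₂ i | A₁ j | A₂ j
  ... | a | .a | refl | x | y | z | w rewrite ∧-comm' x w | ∧-comm' y z | ∨-comm' (w ∧ x) (z ∧ y) = refl

  toggleLoop : ∀ {n} (G : Graph n) A₁ A₂ → Disjoint A₁ A₂ → ∀ i → toggleAdj G A₁ A₂ i i ≡ false
  toggleLoop G A₁ A₂ d i with adj G i i | loopless G i | A₁ i | A₂ i | d i
  ... | .false | refl | false | false | _ = refl
  ... | .false | refl | false | true | _ = refl
  ... | .false | refl | true | false | _ = refl
  ... | .false | refl | true | true | ()

toggle : ∀ {n} → (G : Graph n) → (A₁ A₂ : BVec n) → Disjoint A₁ A₂ → Graph n
toggle G A₁ A₂ d = record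
  { adj = toggleAdj G A₁ A₂
  ; sym = toggleSym G A₁ A₂
  ; loopless = toggleLoop G A₁ A₂ d }

Solvable : ∀ {n} → Mat n → BVec n → Set
Solvable M A = ∃ λ p → (M *ᵥ p) ≋ A

HO : ∀ {n} → Mat n → BVec n → Set
HO M A = ¬ Solvable M A

NO : ∀ {n} → Mat n → BVec n → Set
NO M A = Solvable M A × (∀ p → (M *ᵥ p) ≋ 𝟏 → A · p ≡ false)

lincomb : ∀ {n k} → BVec k → (Fin k → BVec n) → BVec n
lincomb c b i = sumZ2 (λ j → c j ∧ b j i)

KerDim : ∀ {n} → Mat n → ℕ → Set
KerDim {n} M k = Σ (Fin k → BVec n) λ b →
    (∀ j → (M *ᵥ b j) ≋ 𝟎)
  × (∀ c → lincomb c b ≋ 𝟎 → c ≋ 𝟎)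
  × (∀ v → (M *ᵥ v) ≋ 𝟎 → ∃ λ c → lincomb c b ≋ v)

ν≡ : ∀ {n} → Graph n → ℕ → Set
ν≡ H k = KerDim (N H) k

-- Over Z₂, toggling the pairs between A and B turns N into N* = N + A Bᵀ + B Aᵀ, that is
-- N* p = N p + (B·p) A + (A·p) B, so everything reduces to a case split on the two bits A·p and B·p.
-- The all-ones vector is in the image of every symmetric matrix with unit diagonal, because its kernel
-- is orthogonal to 1 (v·Nv = 1·v); hence a mixed case (A·p ≠ B·p) in N* p = 1 would make A or B
-- solvable. For the HO sets the mixed cases are excluded by A·v = B·v, which holds on ker N and on the
-- preimage of A + B because A + B = A ∪ B is solvable and NO. Finally, A being HO in both graphs gives,
-- by the Fredholm alternative, k ∈ ker N and l ∈ ker N* with A·k = A·l = 1, and the transvection v ↦ v + (A·v)(k + l) is a linear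
-- involution exchanging ker N and ker N*, so the two kernels have the same dimension.
module Submission where

open import Defs hiding (sym)
open import Data.Nat using (ℕ; zero; suc)
open import Data.Fin using (Fin; zero; suc; _≟_)
open import Data.Bool using (Bool; true; false; _∧_; _∨_; _xor_; not)
open import Data.Bool.Properties
  using (xor-assoc; xor-comm; xor-same; xor-identityʳ; xor-inverseˡ; not-involutive;
         ∧-comm; ∧-assoc; ∧-idem; ∧-identityʳ; ∧-zeroʳ; ∨-identityʳ; ∧-distribˡ-xor; ∧-distribʳ-xor;
         ∧-commutativeMonoid; xor-∧-commutativeRing)
open import Algebra.Bundles using (CommutativeMonoid; CommutativeRing)
open import Algebra.Properties.CommutativeSemigroup
  (CommutativeRing.+-commutativeSemigroup xor-∧-commutativeRing)
  using () renaming (interchange to xor-interchange)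
open import Algebra.Properties.CommutativeSemigroup
  (CommutativeMonoid.commutativeSemigroup ∧-commutativeMonoid)
  using () renaming (x∙yz≈y∙xz to ∧-exchange; x∙yz≈z∙yx to ∧-reverse)
open import Data.Vec.Functional using (_∷_; head; tail)
open import Data.Product using (_×_; _,_; ∃; proj₁; proj₂)
open import Data.Sum using (_⊎_; inj₁; inj₂)
open import Data.Empty using (⊥-elim)
open import Function.Bundles using (_⇔_; mk⇔)
open import Level using (0ℓ)
open import Relation.Nullary using (yes; no)
open import Relation.Binary.Bundles using (Setoid)
import Relation.Binary.Reasoning.Setoid
open import Relation.Binary.PropositionalEquality
  using (_≡_; _≢_; refl; sym; trans; cong; cong₂; module ≡-Reasoning)

false≢true : false ≢ true
false≢true ()

xor-cancelʳ : ∀ x y → (x xor y) xor y ≡ x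
xor-cancelʳ x y = begin
  (x xor y) xor y  ≡⟨ xor-assoc x y y ⟩
  x xor (y xor y)  ≡⟨ cong (x xor_) (xor-same y) ⟩
  x xor false      ≡⟨ xor-identityʳ x ⟩
  x                ∎
  where open ≡-Reasoning

xor-cancelˡ : ∀ x y → x xor (x xor y) ≡ y
xor-cancelˡ x y = trans (sym (xor-assoc x x y)) (cong (_xor y) (xor-same x))

xor-cancel-middle : ∀ x y z → (x xor y) xor (y xor z) ≡ x xor z
xor-cancel-middle x y z = begin
  (x xor y) xor (y xor z)  ≡⟨ xor-assoc x y (y xor z) ⟩
  x xor (y xor (y xor z))  ≡⟨ cong (x xor_) (sym (xor-assoc y y z)) ⟩
  x xor ((y xor y) xor z)  ≡⟨ cong (λ w → x xor (w xor z)) (xor-same y) ⟩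
  x xor z                  ∎
  where open ≡-Reasoning

xor-moveʳ : ∀ {x y z} → x xor y ≡ z → x ≡ z xor y
xor-moveʳ {x} {y} eq = trans (sym (xor-cancelʳ x y)) (cong (_xor y) eq)

xor≡false⇒≡ : ∀ {x y} → x xor y ≡ false → x ≡ y
xor≡false⇒≡ {x} {y} = xor-moveʳ {x} {y}

∨≡xor-disjoint : ∀ a b x y → a ∧ b ≡ false → (a ∧ x) ∨ (b ∧ y) ≡ (a ∧ x) xor (b ∧ y)
∨≡xor-disjoint false b     x y _ = refl
∨≡xor-disjoint true  false x y _ = trans (∨-identityʳ x) (sym (xor-identityʳ x))
∨≡xor-disjoint true  true  x y ()

infixl 6 _⊕_
infixr 7 _⊛_

_⊕_ : ∀ {n} → BVec n → BVec n → BVec n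
(x ⊕ y) i = x i xor y i

_⊛_ : ∀ {n} → Bool → BVec n → BVec n
(c ⊛ x) i = c ∧ x i

≋-sym : ∀ {n} {x y : BVec n} → x ≋ y → y ≋ x
≋-sym eq i = sym (eq i)

≋-trans : ∀ {n} {x y z : BVec n} → x ≋ y → y ≋ z → x ≋ z
≋-trans eq eq′ i = trans (eq i) (eq′ i)

≋-setoid : ℕ → Setoid 0ℓ 0ℓ
≋-setoid n = record
  { Carrier       = BVec n
  ; _≈_           = _≋_
  ; isEquivalence = record { refl = λ _ → refl ; sym = ≋-sym ; trans = ≋-trans }
  }

module ≋-Reasoning {n} = Relation.Binary.Reasoning.Setoid (≋-setoid n)

⊕-comm : ∀ {n} (x y : BVec n) → (x ⊕ y) ≋ (y ⊕ x)
⊕-comm x y i = xor-comm (x i) (y i)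

⊕-moveʳ : ∀ {n} {x y z : BVec n} → (x ⊕ y) ≋ z → x ≋ (z ⊕ y)
⊕-moveʳ eq i = xor-moveʳ (eq i)

∪≋⊕ : ∀ {n} (A B : BVec n) → Disjoint A B → (A ∪ B) ≋ (A ⊕ B)
∪≋⊕ A B disjoint i with A i | B i | disjoint i
... | false | _     | _ = refl
... | true  | false | _ = refl

sumZ2-cong : ∀ {n} {x y : BVec n} → x ≋ y → sumZ2 x ≡ sumZ2 y
sumZ2-cong {zero}  eq = refl
sumZ2-cong {suc n} eq = cong₂ _xor_ (eq zero) (sumZ2-cong (λ i → eq (suc i)))

sumZ2-𝟎 : ∀ {n} → sumZ2 (𝟎 {n}) ≡ false
sumZ2-𝟎 {zero}  = refl
sumZ2-𝟎 {suc n} = sumZ2-𝟎 {n}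

sumZ2-⊕ : ∀ {n} (x y : BVec n) → sumZ2 (x ⊕ y) ≡ sumZ2 x xor sumZ2 y
sumZ2-⊕ {zero}  x y = refl
sumZ2-⊕ {suc n} x y = begin
  (x zero xor y zero) xor sumZ2 (tail x ⊕ tail y)
    ≡⟨ cong ((x zero xor y zero) xor_) (sumZ2-⊕ (tail x) (tail y)) ⟩
  (x zero xor y zero) xor (sumZ2 (tail x) xor sumZ2 (tail y))
    ≡⟨ xor-interchange (x zero) (y zero) (sumZ2 (tail x)) (sumZ2 (tail y)) ⟩
  (x zero xor sumZ2 (tail x)) xor (y zero xor sumZ2 (tail y))
    ∎
  where open ≡-Reasoning

sumZ2-⊛ : ∀ {n} c (x : BVec n) → sumZ2 (c ⊛ x) ≡ c ∧ sumZ2 x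
sumZ2-⊛ {zero}  c x = sym (∧-zeroʳ c)
sumZ2-⊛ {suc n} c x = trans (cong ((c ∧ x zero) xor_) (sumZ2-⊛ c (tail x)))
                            (sym (∧-distribˡ-xor c (x zero) (sumZ2 (tail x))))

sumZ2-swap : ∀ {n m} (f : Fin n → Fin m → Bool) →
  sumZ2 (λ i → sumZ2 (f i)) ≡ sumZ2 (λ j → sumZ2 (λ i → f i j))
sumZ2-swap {zero}  {m} f = sym (sumZ2-𝟎 {m})
sumZ2-swap {suc n}     f = trans (cong (sumZ2 (f zero) xor_) (sumZ2-swap (tail f)))
                                 (sym (sumZ2-⊕ (f zero) (λ j → sumZ2 (λ i → f (suc i) j))))

·-congˡ : ∀ {n} {x x′ : BVec n} (y : BVec n) → x ≋ x′ → x · y ≡ x′ · y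
·-congˡ y eq = sumZ2-cong (λ i → cong (_∧ y i) (eq i))

·-congʳ : ∀ {n} (x : BVec n) {y y′ : BVec n} → y ≋ y′ → x · y ≡ x · y′
·-congʳ x eq = sumZ2-cong (λ i → cong (x i ∧_) (eq i))

·-comm : ∀ {n} (x y : BVec n) → x · y ≡ y · x
·-comm x y = sumZ2-cong (λ i → ∧-comm (x i) (y i))

·-zeroʳ : ∀ {n} (x : BVec n) → x · 𝟎 ≡ false
·-zeroʳ {n} x = trans (sumZ2-cong (λ i → ∧-zeroʳ (x i))) (sumZ2-𝟎 {n})

·-distribʳ-⊕ : ∀ {n} (x y z : BVec n) → x · (y ⊕ z) ≡ (x · y) xor (x · z)
·-distribʳ-⊕ x y z = trans (sumZ2-cong (λ i → ∧-distribˡ-xor (x i) (y i) (z i)))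
                           (sumZ2-⊕ (λ i → x i ∧ y i) (λ i → x i ∧ z i))

·-distribˡ-⊕ : ∀ {n} (x y z : BVec n) → (x ⊕ y) · z ≡ (x · z) xor (y · z)
·-distribˡ-⊕ x y z = trans (·-comm (x ⊕ y) z)
  (trans (·-distribʳ-⊕ z x y) (cong₂ _xor_ (·-comm z x) (·-comm z y)))

·-⊛ˡ : ∀ {n} c (x y : BVec n) → (c ⊛ x) · y ≡ c ∧ (x · y)
·-⊛ˡ c x y = trans (sumZ2-cong (λ i → ∧-assoc c (x i) (y i))) (sumZ2-⊛ c (λ i → x i ∧ y i))

·-⊛ʳ : ∀ {n} (x : BVec n) c (y : BVec n) → x · (c ⊛ y) ≡ c ∧ (x · y)
·-⊛ʳ x c y = trans (sumZ2-cong (λ i → ∧-exchange (x i) c (y i))) (sumZ2-⊛ c (λ i → x i ∧ y i))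

·-⊕⊛ : ∀ {n} (u : BVec n) a (w z : BVec n) → (u ⊕ a ⊛ w) · z ≡ (u · z) xor (a ∧ (w · z))
·-⊕⊛ u a w z = trans (·-distribˡ-⊕ u (a ⊛ w) z) (cong ((u · z) xor_) (·-⊛ˡ a w z))

·-eliminate : ∀ {n} (u w z : BVec n) → w · z ≡ true → (u ⊕ (u · z) ⊛ w) · z ≡ false
·-eliminate u w z w·z≡true = begin
  (u ⊕ (u · z) ⊛ w) · z             ≡⟨ ·-⊕⊛ u (u · z) w z ⟩
  (u · z) xor ((u · z) ∧ (w · z))   ≡⟨ cong (λ t → (u · z) xor ((u · z) ∧ t)) w·z≡true ⟩
  (u · z) xor ((u · z) ∧ true)      ≡⟨ cong ((u · z) xor_) (∧-identityʳ (u · z)) ⟩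
  (u · z) xor (u · z)               ≡⟨ xor-same (u · z) ⟩
  false                             ∎
  where open ≡-Reasoning

*ᵥ-cong : ∀ {n} (M : Mat n) {x y : BVec n} → x ≋ y → (M *ᵥ x) ≋ (M *ᵥ y)
*ᵥ-cong M eq i = ·-congʳ (M i) eq

*ᵥ-⊕ : ∀ {n} (M : Mat n) (x y : BVec n) → (M *ᵥ (x ⊕ y)) ≋ ((M *ᵥ x) ⊕ (M *ᵥ y))
*ᵥ-⊕ M x y i = ·-distribʳ-⊕ (M i) x y

*ᵥ-⊛ : ∀ {n} (M : Mat n) c (x : BVec n) → (M *ᵥ (c ⊛ x)) ≋ (c ⊛ (M *ᵥ x))
*ᵥ-⊛ M c x i = ·-⊛ʳ (M i) c x

Symmetric : ∀ {n} → Mat n → Set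
Symmetric M = ∀ i j → M i j ≡ M j i

UnitDiagonal : ∀ {n} → Mat n → Set
UnitDiagonal M = ∀ i → M i i ≡ true

Ker : ∀ {n} → Mat n → BVec n → Set
Ker M v = (M *ᵥ v) ≋ 𝟎

Preimage : ∀ {n} → Mat n → BVec n → BVec n → Set
Preimage M x v = (M *ᵥ v) ≋ x

Solvable-cong : ∀ {n} (M : Mat n) {x y : BVec n} → x ≋ y → Solvable M x → Solvable M y
Solvable-cong M x≋y (p , Mp≋x) = p , ≋-trans Mp≋x x≋y

·-*ᵥ-expand : ∀ {n} (x : BVec n) (M : Mat n) (y : BVec n) →
  x · (M *ᵥ y) ≡ sumZ2 (λ i → sumZ2 (λ j → x i ∧ (M i j ∧ y j)))
·-*ᵥ-expand x M y = sumZ2-cong (λ i → sym (sumZ2-⊛ (x i) (λ j → M i j ∧ y j)))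

*ᵥ-selfAdjoint : ∀ {n} (M : Mat n) → Symmetric M → ∀ x y → (M *ᵥ x) · y ≡ x · (M *ᵥ y)
*ᵥ-selfAdjoint M symM x y = begin
  (M *ᵥ x) · y                                     ≡⟨ ·-comm (M *ᵥ x) y ⟩
  y · (M *ᵥ x)                                     ≡⟨ ·-*ᵥ-expand y M x ⟩
  sumZ2 (λ i → sumZ2 (λ j → y i ∧ (M i j ∧ x j)))  ≡⟨ sumZ2-swap (λ i j → y i ∧ (M i j ∧ x j)) ⟩
  sumZ2 (λ j → sumZ2 (λ i → y i ∧ (M i j ∧ x j)))  ≡⟨ sumZ2-cong (λ j → sumZ2-cong (transposeTerm j)) ⟩
  sumZ2 (λ j → sumZ2 (λ i → x j ∧ (M j i ∧ y i)))  ≡⟨ ·-*ᵥ-expand x M y ⟨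
  x · (M *ᵥ y)                                     ∎
  where
  open ≡-Reasoning
  transposeTerm : ∀ j i → y i ∧ (M i j ∧ x j) ≡ x j ∧ (M j i ∧ y i)
  transposeTerm j i = trans (∧-reverse (y i) (M i j) (x j)) (cong (λ m → x j ∧ (m ∧ y i)) (symM i j))

-- The off-diagonal terms vᵢ Mᵢⱼ vⱼ and vⱼ Mⱼᵢ vᵢ cancel in pairs.
quadraticForm : ∀ {n} (M : Mat n) → Symmetric M → ∀ v → v · (M *ᵥ v) ≡ sumZ2 (λ i → M i i ∧ v i)
quadraticForm {zero}  M symM v = refl
quadraticForm {suc n} M symM v = begin
  v · (M *ᵥ v)
    ≡⟨ cong₂ _xor_ (∧-distribˡ-xor v₀ (M zero zero ∧ v₀) r) (·-distribʳ-⊕ v′ c (M′ *ᵥ v′)) ⟩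
  ((v₀ ∧ (M zero zero ∧ v₀)) xor (v₀ ∧ r)) xor ((v′ · c) xor (v′ · (M′ *ᵥ v′)))
    ≡⟨ cong₂ (λ s t → (s xor (v₀ ∧ r)) xor (t xor (v′ · (M′ *ᵥ v′)))) diagonalTerm crossTerm ⟩
  ((M zero zero ∧ v₀) xor (v₀ ∧ r)) xor ((v₀ ∧ r) xor (v′ · (M′ *ᵥ v′)))
    ≡⟨ xor-cancel-middle (M zero zero ∧ v₀) (v₀ ∧ r) (v′ · (M′ *ᵥ v′)) ⟩
  (M zero zero ∧ v₀) xor (v′ · (M′ *ᵥ v′))
    ≡⟨ cong ((M zero zero ∧ v₀) xor_) (quadraticForm M′ (λ i j → symM (suc i) (suc j)) v′) ⟩
  sumZ2 (λ i → M i i ∧ v i)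
    ∎
  where
  open ≡-Reasoning
  v₀ : Bool
  v₀ = v zero
  v′ c : BVec n
  v′ = tail v
  c i = M (suc i) zero ∧ v₀
  M′ : Mat n
  M′ i j = M (suc i) (suc j)
  r : Bool
  r = (λ j → M zero (suc j)) · v′
  diagonalTerm : v₀ ∧ (M zero zero ∧ v₀) ≡ M zero zero ∧ v₀
  diagonalTerm = trans (∧-exchange v₀ (M zero zero) v₀) (cong (M zero zero ∧_) (∧-idem v₀))
  crossTerm : v′ · c ≡ v₀ ∧ r
  crossTerm = trans
    (sumZ2-cong (λ i → trans (∧-reverse (v′ i) (M (suc i) zero) v₀)
                             (cong (λ m → v₀ ∧ (m ∧ v′ i)) (symM (suc i) zero))))
    (sumZ2-⊛ v₀ (λ i → M zero (suc i) ∧ v′ i))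

InSpan : ∀ {n m} → (Fin m → BVec n) → BVec n → Set
InSpan b x = ∃ λ c → lincomb c b ≋ x

Separates : ∀ {n m} → BVec n → (Fin m → BVec n) → BVec n → Set
Separates y b x = (∀ j → y · b j ≡ false) × (y · x ≡ true)

≋𝟎⊎detected : ∀ {n} (x : BVec n) → x ≋ 𝟎 ⊎ ∃ λ y → y · x ≡ true
≋𝟎⊎detected {zero}  x = inj₁ (λ ())
≋𝟎⊎detected {suc n} x with x zero in x₀
... | true  = inj₂ (true ∷ 𝟎 , cong not (sumZ2-𝟎 {n}))
... | false with ≋𝟎⊎detected (tail x)
...   | inj₁ x′≋𝟎      = inj₁ (λ { zero → x₀ ; (suc i) → x′≋𝟎 i })
...   | inj₂ (y , yx′) = inj₂ (false ∷ y , yx′)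

-- Gaussian elimination on the first column b₀: when y separates x from b₁, b₂, … with y·b₀ = 1 and
-- y′ separates x + b₀ from b₁, b₂, …, the vector y′ + (y′·b₀) y separates x from all columns.
span-alternative : ∀ {n m} (b : Fin m → BVec n) x → InSpan b x ⊎ ∃ λ y → Separates y b x
span-alternative {m = zero} b x with ≋𝟎⊎detected x
... | inj₁ x≋𝟎      = inj₁ ((λ ()) , ≋-sym x≋𝟎)
... | inj₂ (y , yx) = inj₂ (y , (λ ()) , yx)
span-alternative {m = suc m} b x with span-alternative (tail b) x
... | inj₁ (c , bc≋x) = inj₁ (false ∷ c , bc≋x)
... | inj₂ (y , y⊥ , yx) with y · head b in yb₀
...   | false = inj₂ (y , (λ { zero → yb₀ ; (suc j) → y⊥ j }) , yx)
...   | true with span-alternative (tail b) (x ⊕ head b)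
...     | inj₁ (c , bc≋x⊕b₀) =
  inj₁ (true ∷ c , λ i → trans (cong (head b i xor_) (bc≋x⊕b₀ i))
                               (trans (xor-comm (head b i) _) (xor-cancelʳ (x i) (head b i))))
...     | inj₂ (y′ , y′⊥ , y′x⊕b₀) =
  inj₂ (y″ , (λ { zero → ·-eliminate y′ y (head b) yb₀ ; (suc j) → y″⊥ j }) , y″x)
  where
  y″ : BVec _
  y″ = y′ ⊕ (y′ · head b) ⊛ y
  y″⊥ : ∀ j → y″ · b (suc j) ≡ false
  y″⊥ j = trans (·-⊕⊛ y′ (y′ · head b) y (b (suc j)))
                (trans (cong₂ (λ s t → s xor ((y′ · head b) ∧ t)) (y′⊥ j) (y⊥ j)) (∧-zeroʳ _))
  y″x : y″ · x ≡ true
  y″x = begin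
    y″ · x                                  ≡⟨ ·-⊕⊛ y′ (y′ · head b) y x ⟩
    (y′ · x) xor ((y′ · head b) ∧ (y · x))  ≡⟨ cong (λ t → (y′ · x) xor ((y′ · head b) ∧ t)) yx ⟩
    (y′ · x) xor ((y′ · head b) ∧ true)     ≡⟨ cong ((y′ · x) xor_) (∧-identityʳ (y′ · head b)) ⟩
    (y′ · x) xor (y′ · head b)              ≡⟨ ·-distribʳ-⊕ y′ x (head b) ⟨
    y′ · (x ⊕ head b)                       ≡⟨ y′x⊕b₀ ⟩
    true                                    ∎
    where open ≡-Reasoning

module _ {n} {M : Mat n} (symM : Symmetric M) where

  Solvable⊎kernelWitness : ∀ x → Solvable M x ⊎ ∃ λ y → Ker M y × (x · y ≡ true)
  Solvable⊎kernelWitness x with span-alternative M x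
  ... | inj₁ (c , Mc≋x) = inj₁ (c , λ i → trans (sumZ2-cong (transposeTerm i)) (Mc≋x i))
    where
    transposeTerm : ∀ i j → M i j ∧ c j ≡ c j ∧ M j i
    transposeTerm i j = trans (∧-comm (M i j) (c j)) (cong (c j ∧_) (symM i j))
  ... | inj₂ (y , y⊥M , yx) =
    inj₂ (y , (λ j → trans (·-comm (M j) y) (y⊥M j)) , trans (·-comm x y) yx)

  HO⇒kernelWitness : ∀ {x} → HO M x → ∃ λ y → Ker M y × (x · y ≡ true)
  HO⇒kernelWitness {x} ho with Solvable⊎kernelWitness x
  ... | inj₁ solvable = ⊥-elim (ho solvable)
  ... | inj₂ witness  = witness

  solvable⊥kernel : ∀ {x v} → Solvable M x → Ker M v → x · v ≡ false
  solvable⊥kernel {x} {v} (r , Mr≋x) Mv≋𝟎 = begin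
    x · v         ≡⟨ ·-congˡ v (≋-sym Mr≋x) ⟩
    (M *ᵥ r) · v  ≡⟨ *ᵥ-selfAdjoint M symM r v ⟩
    r · (M *ᵥ v)  ≡⟨ ·-congʳ r Mv≋𝟎 ⟩
    r · 𝟎         ≡⟨ ·-zeroʳ r ⟩
    false         ∎
    where open ≡-Reasoning

  module _ (unitM : UnitDiagonal M) where

    quadraticForm-unitDiagonal : ∀ v → v · (M *ᵥ v) ≡ 𝟏 · v
    quadraticForm-unitDiagonal v =
      trans (quadraticForm M symM v) (sumZ2-cong (λ i → cong (_∧ v i) (unitM i)))

    kernel⊥𝟏 : ∀ {v} → Ker M v → 𝟏 · v ≡ false
    kernel⊥𝟏 {v} Mv≋𝟎 =
      trans (sym (quadraticForm-unitDiagonal v)) (trans (·-congʳ v Mv≋𝟎) (·-zeroʳ v))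

    𝟏-solvable : Solvable M 𝟏
    𝟏-solvable with Solvable⊎kernelWitness 𝟏
    ... | inj₁ solvable        = solvable
    ... | inj₂ (y , My≋𝟎 , 𝟏y) = ⊥-elim (false≢true (trans (sym (kernel⊥𝟏 My≋𝟎)) 𝟏y))

    NO⇒preimage⊥ : ∀ {x v} → NO M x → Preimage M x v → x · v ≡ false
    NO⇒preimage⊥ {x} {v} (_ , x⊥𝟏-preimages) Mv≋x = begin
      x · v         ≡⟨ ·-congˡ v (≋-sym Mv≋x) ⟩
      (M *ᵥ v) · v  ≡⟨ ·-comm (M *ᵥ v) v ⟩
      v · (M *ᵥ v)  ≡⟨ quadraticForm-unitDiagonal v ⟩
      𝟏 · v         ≡⟨ ·-congˡ v (≋-sym Mq≋𝟏) ⟩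
      (M *ᵥ q) · v  ≡⟨ *ᵥ-selfAdjoint M symM q v ⟩
      q · (M *ᵥ v)  ≡⟨ ·-congʳ q Mv≋x ⟩
      q · x         ≡⟨ ·-comm q x ⟩
      x · q         ≡⟨ x⊥𝟏-preimages q Mq≋𝟏 ⟩
      false         ∎
      where
      open ≡-Reasoning
      q : BVec n
      q = proj₁ 𝟏-solvable
      Mq≋𝟏 : (M *ᵥ q) ≋ 𝟏
      Mq≋𝟏 = proj₂ 𝟏-solvable

record IsLinear {n} (f : BVec n → BVec n) : Set where
  field
    cong-≋ : ∀ {x y} → x ≋ y → f x ≋ f y
    ⊕-hom  : ∀ x y → f (x ⊕ y) ≋ (f x ⊕ f y)
    ⊛-hom  : ∀ c x → f (c ⊛ x) ≋ (c ⊛ f x)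

  𝟎-hom : f 𝟎 ≋ 𝟎
  𝟎-hom = ⊛-hom false 𝟎

  lincomb-hom : ∀ {m} (c : BVec m) (b : Fin m → BVec n) →
    lincomb c (λ j → f (b j)) ≋ f (lincomb c b)
  lincomb-hom {zero}  c b = ≋-sym 𝟎-hom
  lincomb-hom {suc m} c b = begin
    (head c ⊛ f (head b)) ⊕ lincomb (tail c) (λ j → f (tail b j))
      ≈⟨ (λ i → cong ((head c ∧ f (head b) i) xor_) (lincomb-hom (tail c) (tail b) i)) ⟩
    (head c ⊛ f (head b)) ⊕ f (lincomb (tail c) (tail b))
      ≈⟨ (λ i → cong (_xor f (lincomb (tail c) (tail b)) i) (⊛-hom (head c) (head b) i)) ⟨
    f (head c ⊛ head b) ⊕ f (lincomb (tail c) (tail b))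
      ≈⟨ ⊕-hom (head c ⊛ head b) (lincomb (tail c) (tail b)) ⟨
    f (lincomb c b)
      ∎
    where open ≋-Reasoning

KerDim-transport : ∀ {n k} {P Q : Mat n} {f : BVec n → BVec n} →
  IsLinear f → (∀ v → f (f v) ≋ v) →
  (∀ v → Ker P v → Ker Q (f v)) → (∀ v → Ker Q v → Ker P (f v)) → KerDim P k → KerDim Q k
KerDim-transport {Q = Q} {f} linear involutive P→Q Q→P (b , b∈ker , independent , spanning) =
  (λ j → f (b j)) , (λ j → P→Q (b j) (b∈ker j)) , independent′ , spanning′
  where
  open IsLinear linear
  open ≋-Reasoning
  independent′ : ∀ c → lincomb c (λ j → f (b j)) ≋ 𝟎 → c ≋ 𝟎
  independent′ c fbc≋𝟎 = independent c (begin
    lincomb c b                     ≈⟨ involutive (lincomb c b) ⟨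
    f (f (lincomb c b))             ≈⟨ cong-≋ (lincomb-hom c b) ⟨
    f (lincomb c (λ j → f (b j)))   ≈⟨ cong-≋ fbc≋𝟎 ⟩
    f 𝟎                             ≈⟨ 𝟎-hom ⟩
    𝟎                               ∎)
  spanning′ : ∀ v → Ker Q v → ∃ λ c → lincomb c (λ j → f (b j)) ≋ v
  spanning′ v Qv≋𝟎 with spanning (f v) (Q→P v Qv≋𝟎)
  ... | c , bc≋fv = c , (begin
    lincomb c (λ j → f (b j))   ≈⟨ lincomb-hom c b ⟩
    f (lincomb c b)             ≈⟨ cong-≋ bc≋fv ⟩
    f (f v)                     ≈⟨ involutive v ⟩
    v                           ∎)

transvection : ∀ {n} → BVec n → BVec n → BVec n → BVec n
transvection a u v = v ⊕ (a · v) ⊛ u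

transvection-linear : ∀ {n} (a u : BVec n) → IsLinear (transvection a u)
transvection-linear a u = record
  { cong-≋ = λ x≋y i → cong₂ (λ s t → s xor (t ∧ u i)) (x≋y i) (·-congʳ a x≋y)
  ; ⊕-hom  = ⊕-hom
  ; ⊛-hom  = ⊛-hom
  }
  where
  open ≡-Reasoning
  ⊕-hom : ∀ x y → transvection a u (x ⊕ y) ≋ (transvection a u x ⊕ transvection a u y)
  ⊕-hom x y i = begin
    (x i xor y i) xor ((a · (x ⊕ y)) ∧ u i)
      ≡⟨ cong (λ t → (x i xor y i) xor (t ∧ u i)) (·-distribʳ-⊕ a x y) ⟩
    (x i xor y i) xor (((a · x) xor (a · y)) ∧ u i)
      ≡⟨ cong ((x i xor y i) xor_) (∧-distribʳ-xor (u i) (a · x) (a · y)) ⟩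
    (x i xor y i) xor (((a · x) ∧ u i) xor ((a · y) ∧ u i))
      ≡⟨ xor-interchange (x i) (y i) ((a · x) ∧ u i) ((a · y) ∧ u i) ⟩
    (x i xor ((a · x) ∧ u i)) xor (y i xor ((a · y) ∧ u i))
      ∎
  ⊛-hom : ∀ c x → transvection a u (c ⊛ x) ≋ (c ⊛ transvection a u x)
  ⊛-hom c x i = begin
    (c ∧ x i) xor ((a · (c ⊛ x)) ∧ u i)  ≡⟨ cong (λ t → (c ∧ x i) xor (t ∧ u i)) (·-⊛ʳ a c x) ⟩
    (c ∧ x i) xor ((c ∧ (a · x)) ∧ u i)  ≡⟨ cong ((c ∧ x i) xor_) (∧-assoc c (a · x) (u i)) ⟩
    (c ∧ x i) xor (c ∧ ((a · x) ∧ u i))  ≡⟨ ∧-distribˡ-xor c (x i) ((a · x) ∧ u i) ⟨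
    c ∧ (x i xor ((a · x) ∧ u i))        ∎

transvection-involutive : ∀ {n} (a u : BVec n) → a · u ≡ false →
  ∀ v → transvection a u (transvection a u v) ≋ v
transvection-involutive a u a·u≡false v i = begin
  (v i xor ((a · v) ∧ u i)) xor ((a · transvection a u v) ∧ u i)
    ≡⟨ cong (λ t → (v i xor ((a · v) ∧ u i)) xor (t ∧ u i)) a·τv≡a·v ⟩
  (v i xor ((a · v) ∧ u i)) xor ((a · v) ∧ u i)
    ≡⟨ xor-cancelʳ (v i) ((a · v) ∧ u i) ⟩
  v i
    ∎
  where
  open ≡-Reasoning
  a·τv≡a·v : a · transvection a u v ≡ a · v
  a·τv≡a·v = begin
    a · (v ⊕ (a · v) ⊛ u)            ≡⟨ ·-distribʳ-⊕ a v ((a · v) ⊛ u) ⟩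
    (a · v) xor (a · ((a · v) ⊛ u))  ≡⟨ cong ((a · v) xor_) (·-⊛ʳ a (a · v) u) ⟩
    (a · v) xor ((a · v) ∧ (a · u))  ≡⟨ cong (λ t → (a · v) xor ((a · v) ∧ t)) a·u≡false ⟩
    (a · v) xor ((a · v) ∧ false)    ≡⟨ cong ((a · v) xor_) (∧-zeroʳ (a · v)) ⟩
    (a · v) xor false                ≡⟨ xor-identityʳ (a · v) ⟩
    a · v                            ∎

Toggled : ∀ {n} → BVec n → BVec n → Mat n → Mat n → Set
Toggled A B M M′ = ∀ p → (M′ *ᵥ p) ≋ ((M *ᵥ p) ⊕ ((B · p) ⊛ A ⊕ (A · p) ⊛ B))

AgreeOn : ∀ {n} → BVec n → BVec n → (BVec n → Set) → Set
AgreeOn A B S = ∀ v → S v → A · v ≡ B · v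

module _ {n} {A B : BVec n} {M M′ : Mat n} where

  Toggled-sym : Toggled A B M M′ → Toggled A B M′ M
  Toggled-sym toggled p = ⊕-moveʳ (≋-sym (toggled p))

  Toggled-swap : Toggled A B M M′ → Toggled B A M M′
  Toggled-swap toggled p i =
    trans (toggled p i) (cong ((M *ᵥ p) i xor_) (xor-comm ((B · p) ∧ A i) ((A · p) ∧ B i)))

module ToggledTheory {n} {A B : BVec n} {M M′ : Mat n} (toggled : Toggled A B M M′) where

  toggled-at : ∀ {p a b} → A · p ≡ a → B · p ≡ b → (M′ *ᵥ p) ≋ ((M *ᵥ p) ⊕ (b ⊛ A ⊕ a ⊛ B))
  toggled-at refl refl = toggled _

  toggled-back : ∀ {p x a b} → (M′ *ᵥ p) ≋ x → A · p ≡ a → B · p ≡ b →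
    (M *ᵥ p) ≋ (x ⊕ (b ⊛ A ⊕ a ⊛ B))
  toggled-back M′p≋x a b = ⊕-moveʳ (≋-trans (≋-sym (toggled-at a b)) M′p≋x)

  toggled-kernel : ∀ {v} → Ker M v → A · v ≡ B · v → (M′ *ᵥ v) ≋ ((A · v) ⊛ (A ⊕ B))
  toggled-kernel {v} Mv≋𝟎 A·v≡B·v i = begin
    (M′ *ᵥ v) i
      ≡⟨ toggled v i ⟩
    (M *ᵥ v) i xor (((B · v) ∧ A i) xor ((A · v) ∧ B i))
      ≡⟨ cong₂ (λ s t → s xor ((t ∧ A i) xor ((A · v) ∧ B i))) (Mv≋𝟎 i) (sym A·v≡B·v) ⟩
    ((A · v) ∧ A i) xor ((A · v) ∧ B i)
      ≡⟨ ∧-distribˡ-xor (A · v) (A i) (B i) ⟨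
    (A · v) ∧ (A i xor B i)
      ∎
    where open ≡-Reasoning

  𝟏⊕-preimage⇒Solvable : ∀ {p x} → Solvable M 𝟏 → (M *ᵥ p) ≋ (𝟏 ⊕ x) → Solvable M x
  𝟏⊕-preimage⇒Solvable {p} {x} (q , Mq≋𝟏) Mp≋𝟏⊕x = q ⊕ p , λ i →
    trans (*ᵥ-⊕ M q p i) (trans (cong₂ _xor_ (Mq≋𝟏 i) (Mp≋𝟏⊕x i)) (not-involutive (x i)))

  𝟏PreimageCases : BVec n → Set
  𝟏PreimageCases p = (((M *ᵥ p) ≋ 𝟏) × (A · p ≡ false) × (B · p ≡ false))
                   ⊎ (((M *ᵥ p) ≋ ‾ (A ∪ B)) × (A · p ≡ true) × (B · p ≡ true))

  𝟏-preimage-iff : Disjoint A B → Solvable M 𝟏 → HO M A → HO M B →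
    ∀ p → ((M′ *ᵥ p) ≋ 𝟏) ⇔ 𝟏PreimageCases p
  𝟏-preimage-iff disjoint 𝟏-solvable hoA hoB p = mk⇔ forward backward
    where
    forward : (M′ *ᵥ p) ≋ 𝟏 → 𝟏PreimageCases p
    forward M′p≋𝟏 with A · p in a | B · p in b
    ... | false | false = inj₁ (toggled-back M′p≋𝟏 a b , refl , refl)
    ... | true  | true  = inj₂ (Mp≋‾A∪B , refl , refl)
      where
      Mp≋‾A∪B : (M *ᵥ p) ≋ ‾ (A ∪ B)
      Mp≋‾A∪B i = trans (toggled-back M′p≋𝟏 a b i) (cong not (sym (∪≋⊕ A B disjoint i)))
    ... | false | true  = ⊥-elim (hoA (Solvable-cong M (λ i → xor-identityʳ (A i))
                                        (𝟏⊕-preimage⇒Solvable 𝟏-solvable (toggled-back M′p≋𝟏 a b))))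
    ... | true  | false = ⊥-elim (hoB (𝟏⊕-preimage⇒Solvable 𝟏-solvable (toggled-back M′p≋𝟏 a b)))
    backward : 𝟏PreimageCases p → (M′ *ᵥ p) ≋ 𝟏
    backward (inj₁ (Mp≋𝟏 , a , b)) i = trans (toggled-at a b i) (cong (_xor false) (Mp≋𝟏 i))
    backward (inj₂ (Mp≋‾A∪B , a , b)) i = begin
      (M′ *ᵥ p) i                          ≡⟨ toggled-at a b i ⟩
      (M *ᵥ p) i xor (A i xor B i)         ≡⟨ cong (_xor (A i xor B i)) (Mp≋‾A∪B i) ⟩
      not ((A ∪ B) i) xor (A i xor B i)    ≡⟨ cong (λ t → not t xor (A i xor B i)) (∪≋⊕ A B disjoint i) ⟩
      not (A i xor B i) xor (A i xor B i)  ≡⟨ xor-inverseˡ (A i xor B i) ⟩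
      true                                 ∎
      where open ≡-Reasoning

  HO-preservedˡ : HO M A → HO M B → AgreeOn A B (Ker M) → AgreeOn A B (Preimage M (A ⊕ B)) → HO M′ A
  HO-preservedˡ hoA hoB agreeKer agreePre (p , M′p≋A) with A · p in a | B · p in b
  ... | false | false = hoA (p , λ i → trans (toggled-back M′p≋A a b i) (xor-identityʳ (A i)))
  ... | true  | true  = hoB (p , λ i → trans (toggled-back M′p≋A a b i) (xor-cancelˡ (A i) (B i)))
  ... | false | true  = false≢true (trans (sym a) (trans (agreeKer p Mp≋𝟎) b))
    where
    Mp≋𝟎 : Ker M p
    Mp≋𝟎 i = trans (toggled-back M′p≋A a b i) (xor-cancelˡ (A i) false)
  ... | true  | false = false≢true (trans (sym b) (trans (sym (agreePre p (toggled-back M′p≋A a b))) a))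

  HO⇒agreeOnKer′ : HO M A → HO M B → AgreeOn A B (Ker M′)
  HO⇒agreeOnKer′ hoA hoB v M′v≋𝟎 with A · v in a | B · v in b
  ... | false | false = refl
  ... | true  | true  = refl
  ... | false | true  = ⊥-elim (hoA (v , λ i → trans (toggled-back M′v≋𝟎 a b i) (xor-identityʳ (A i))))
  ... | true  | false = ⊥-elim (hoB (v , toggled-back M′v≋𝟎 a b))

  kernelWitness-sum : AgreeOn A B (Ker M) → ∀ {k l} → Ker M k → A · k ≡ true → Ker M′ l →
    (M′ *ᵥ (k ⊕ l)) ≋ (A ⊕ B)
  kernelWitness-sum agree {k} {l} Mk≋𝟎 A·k≡true M′l≋𝟎 i = begin
    (M′ *ᵥ (k ⊕ l)) i
      ≡⟨ *ᵥ-⊕ M′ k l i ⟩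
    (M′ *ᵥ k) i xor (M′ *ᵥ l) i
      ≡⟨ cong₂ _xor_ (toggled-kernel Mk≋𝟎 (agree k Mk≋𝟎) i) (M′l≋𝟎 i) ⟩
    ((A · k) ∧ (A i xor B i)) xor false
      ≡⟨ xor-identityʳ ((A · k) ∧ (A i xor B i)) ⟩
    (A · k) ∧ (A i xor B i)
      ≡⟨ cong (_∧ (A i xor B i)) A·k≡true ⟩
    A i xor B i
      ∎
    where open ≡-Reasoning

  transvection-kernel : AgreeOn A B (Ker M) → ∀ {u} → (M′ *ᵥ u) ≋ (A ⊕ B) →
    ∀ v → Ker M v → Ker M′ (transvection A u v)
  transvection-kernel agree {u} M′u≋A⊕B v Mv≋𝟎 i = begin
    (M′ *ᵥ (v ⊕ (A · v) ⊛ u)) i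
      ≡⟨ *ᵥ-⊕ M′ v ((A · v) ⊛ u) i ⟩
    (M′ *ᵥ v) i xor (M′ *ᵥ ((A · v) ⊛ u)) i
      ≡⟨ cong ((M′ *ᵥ v) i xor_) (*ᵥ-⊛ M′ (A · v) u i) ⟩
    (M′ *ᵥ v) i xor ((A · v) ∧ (M′ *ᵥ u) i)
      ≡⟨ cong₂ (λ s t → s xor ((A · v) ∧ t))
               (toggled-kernel Mv≋𝟎 (agree v Mv≋𝟎) i) (M′u≋A⊕B i) ⟩
    ((A · v) ∧ (A i xor B i)) xor ((A · v) ∧ (A i xor B i))
      ≡⟨ xor-same ((A · v) ∧ (A i xor B i)) ⟩
    false
      ∎
    where open ≡-Reasoning

open ToggledTheory using (𝟏-preimage-iff)

Toggled-HO : ∀ {n} {A B : BVec n} {M M′ : Mat n} → Toggled A B M M′ → HO M A → HO M B →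
  AgreeOn A B (Ker M) → AgreeOn A B (Preimage M (A ⊕ B)) → HO M′ A × HO M′ B
Toggled-HO {A = A} {B} toggled hoA hoB agreeKer agreePre =
  ToggledTheory.HO-preservedˡ toggled hoA hoB agreeKer agreePre ,
  ToggledTheory.HO-preservedˡ (Toggled-swap toggled) hoB hoA
    (λ v Mv≋𝟎 → sym (agreeKer v Mv≋𝟎))
    (λ v Mv≋B⊕A → sym (agreePre v (≋-trans Mv≋B⊕A (⊕-comm B A))))

Toggled-KerDim : ∀ {n} {A B : BVec n} {M M′ : Mat n} → Toggled A B M M′ → Symmetric M → Symmetric M′ →
  HO M A → HO M B → HO M′ A → AgreeOn A B (Ker M) → ∀ r → KerDim M r ⇔ KerDim M′ r
Toggled-KerDim {A = A} {B} {M} {M′} toggled symM symM′ hoA hoB hoA′ agree r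
  with HO⇒kernelWitness symM hoA | HO⇒kernelWitness symM′ hoA′
... | k , Mk≋𝟎 , A·k≡true | l , M′l≋𝟎 , A·l≡true =
  mk⇔ (KerDim-transport linear involutive M→M′ M′→M) (KerDim-transport linear involutive M′→M M→M′)
  where
  open ToggledTheory toggled using (HO⇒agreeOnKer′; kernelWitness-sum; transvection-kernel)
  module Reverse = ToggledTheory (Toggled-sym toggled)
  τ : BVec _ → BVec _
  τ = transvection A (k ⊕ l)
  linear : IsLinear τ
  linear = transvection-linear A (k ⊕ l)
  involutive : ∀ v → τ (τ v) ≋ v
  involutive = transvection-involutive A (k ⊕ l)
    (trans (·-distribʳ-⊕ A k l) (cong₂ _xor_ A·k≡true A·l≡true))
  agree′ : AgreeOn A B (Ker M′)
  agree′ = HO⇒agreeOnKer′ hoA hoB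
  M→M′ : ∀ v → Ker M v → Ker M′ (τ v)
  M→M′ = transvection-kernel agree (kernelWitness-sum agree Mk≋𝟎 A·k≡true M′l≋𝟎)
  M′→M : ∀ v → Ker M′ v → Ker M (τ v)
  M′→M = Reverse.transvection-kernel agree′
    (≋-trans (*ᵥ-cong M (⊕-comm k l)) (Reverse.kernelWitness-sum agree′ M′l≋𝟎 A·l≡true Mk≋𝟎))

module _ {n} {M : Mat n} {A B : BVec n} (symM : Symmetric M) (disjoint : Disjoint A B) where

  ∪⊥⇒agree : ∀ v → (A ∪ B) · v ≡ false → A · v ≡ B · v
  ∪⊥⇒agree v A∪B⊥v = xor≡false⇒≡ (begin
    (A · v) xor (B · v)  ≡⟨ ·-distribˡ-⊕ A B v ⟨
    (A ⊕ B) · v          ≡⟨ ·-congˡ v (∪≋⊕ A B disjoint) ⟨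
    (A ∪ B) · v          ≡⟨ A∪B⊥v ⟩
    false                ∎)
    where open ≡-Reasoning

  Solvable-∪⇒agreeOnKer : Solvable M (A ∪ B) → AgreeOn A B (Ker M)
  Solvable-∪⇒agreeOnKer solvable v Mv≋𝟎 = ∪⊥⇒agree v (solvable⊥kernel symM solvable Mv≋𝟎)

  NO-∪⇒agreeOnPreimage : UnitDiagonal M → NO M (A ∪ B) → AgreeOn A B (Preimage M (A ⊕ B))
  NO-∪⇒agreeOnPreimage unitM no∪ v Mv≋A⊕B =
    ∪⊥⇒agree v (NO⇒preimage⊥ symM unitM no∪ (≋-trans Mv≋A⊕B (≋-sym (∪≋⊕ A B disjoint))))

entrywise⇒Toggled : ∀ {n} {A B : BVec n} {M M′ : Mat n} →
  (∀ i j → M′ i j ≡ M i j xor ((A i ∧ B j) xor (B i ∧ A j))) → Toggled A B M M′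
entrywise⇒Toggled {A = A} {B} {M} {M′} entry p i = begin
  (M′ *ᵥ p) i
    ≡⟨ sumZ2-cong (λ j → trans (cong (_∧ p j) (entry i j)) (distribute j)) ⟩
  sumZ2 (Mp ⊕ (A i ⊛ Bp ⊕ B i ⊛ Ap))
    ≡⟨ sumZ2-⊕ Mp (A i ⊛ Bp ⊕ B i ⊛ Ap) ⟩
  (M *ᵥ p) i xor sumZ2 (A i ⊛ Bp ⊕ B i ⊛ Ap)
    ≡⟨ cong ((M *ᵥ p) i xor_) (sumZ2-⊕ (A i ⊛ Bp) (B i ⊛ Ap)) ⟩
  (M *ᵥ p) i xor (sumZ2 (A i ⊛ Bp) xor sumZ2 (B i ⊛ Ap))
    ≡⟨ cong ((M *ᵥ p) i xor_) (cong₂ _xor_ (sumZ2-⊛ (A i) Bp) (sumZ2-⊛ (B i) Ap)) ⟩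
  (M *ᵥ p) i xor ((A i ∧ (B · p)) xor (B i ∧ (A · p)))
    ≡⟨ cong ((M *ᵥ p) i xor_) (cong₂ _xor_ (∧-comm (A i) (B · p)) (∧-comm (B i) (A · p))) ⟩
  (M *ᵥ p) i xor (((B · p) ∧ A i) xor ((A · p) ∧ B i))
    ∎
  where
  open ≡-Reasoning
  Mp Ap Bp : BVec _
  Mp j = M i j ∧ p j
  Ap j = A j ∧ p j
  Bp j = B j ∧ p j
  distribute : ∀ j → (M i j xor ((A i ∧ B j) xor (B i ∧ A j))) ∧ p j
                   ≡ Mp j xor ((A i ∧ Bp j) xor (B i ∧ Ap j))
  distribute j = begin
    (M i j xor ((A i ∧ B j) xor (B i ∧ A j))) ∧ p j
      ≡⟨ ∧-distribʳ-xor (p j) (M i j) ((A i ∧ B j) xor (B i ∧ A j)) ⟩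
    Mp j xor (((A i ∧ B j) xor (B i ∧ A j)) ∧ p j)
      ≡⟨ cong (Mp j xor_) (∧-distribʳ-xor (p j) (A i ∧ B j) (B i ∧ A j)) ⟩
    Mp j xor (((A i ∧ B j) ∧ p j) xor ((B i ∧ A j) ∧ p j))
      ≡⟨ cong (Mp j xor_) (cong₂ _xor_ (∧-assoc (A i) (B j) (p j)) (∧-assoc (B i) (A j) (p j))) ⟩
    Mp j xor ((A i ∧ Bp j) xor (B i ∧ Ap j))
      ∎

N-symmetric : ∀ {n} (H : Graph n) → Symmetric (N H)
N-symmetric H i j with i ≟ j | j ≟ i
... | yes _   | yes _   = refl
... | yes i≡j | no j≢i  = ⊥-elim (j≢i (sym i≡j))
... | no i≢j  | yes j≡i = ⊥-elim (i≢j (sym j≡i))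
... | no _    | no _    = Graph.sym H i j

N-unitDiagonal : ∀ {n} (H : Graph n) → UnitDiagonal (N H)
N-unitDiagonal H i with i ≟ i
... | yes _  = refl
... | no i≢i = ⊥-elim (i≢i refl)

N-toggle : ∀ {n} (G : Graph n) (A B : BVec n) (disjoint : Disjoint A B) →
  ∀ i j → N (toggle G A B disjoint) i j ≡ N G i j xor ((A i ∧ B j) xor (B i ∧ A j))
N-toggle G A B disjoint i j with i ≟ j
... | yes refl = cong not (sym (cong₂ _xor_ (disjoint i) (trans (∧-comm (B i) (A i)) (disjoint i))))
... | no _     = cong (adj G i j xor_) (∨≡xor-disjoint (A i) (B i) (B j) (A j) (disjoint i))

mainTheorem19 : ∀ {n} (G : Graph n) (A₁ A₂ : BVec n) (d : Disjoint A₁ A₂) →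
    HO (N G) A₁ → HO (N G) A₂ → NO (N G) (A₁ ∪ A₂) →
    ((∀ p → ((N (toggle G A₁ A₂ d) *ᵥ p) ≋ 𝟏) ⇔
        ((((N G *ᵥ p) ≋ 𝟏) × (A₁ · p ≡ false) × (A₂ · p ≡ false))
         ⊎ (((N G *ᵥ p) ≋ ‾ (A₁ ∪ A₂)) × (A₁ · p ≡ true) × (A₂ · p ≡ true))))
    × HO (N (toggle G A₁ A₂ d)) A₁
    × HO (N (toggle G A₁ A₂ d)) A₂
    × (∀ k → ν≡ G k ⇔ ν≡ (toggle G A₁ A₂ d) k))
mainTheorem19 G A₁ A₂ d hoA₁ hoA₂ noA₁∪A₂ =
  𝟏-preimage-iff toggled d (𝟏-solvable symN unitN) hoA₁ hoA₂ ,
  proj₁ HO′ ,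
  proj₂ HO′ ,
  Toggled-KerDim toggled symN (N-symmetric (toggle G A₁ A₂ d)) hoA₁ hoA₂ (proj₁ HO′) agreeKer
  where
  toggled : Toggled A₁ A₂ (N G) (N (toggle G A₁ A₂ d))
  toggled = entrywise⇒Toggled (N-toggle G A₁ A₂ d)
  symN : Symmetric (N G)
  symN = N-symmetric G
  unitN : UnitDiagonal (N G)
  unitN = N-unitDiagonal G
  agreeKer : AgreeOn A₁ A₂ (Ker (N G))
  agreeKer = Solvable-∪⇒agreeOnKer symN d (proj₁ noA₁∪A₂)
  HO′ : HO (N (toggle G A₁ A₂ d)) A₁ × HO (N (toggle G A₁ A₂ d)) A₂
  HO′ = Toggled-HO toggled hoA₁ hoA₂ agreeKer (NO-∪⇒agreeOnPreimage symN d unitN noA₁∪A₂)
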